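{- Let $F$ be a cuspidal eigenform of weight $k\geq4$, level $N$ with $p\nmid N$ and trivial nebentypus, let $\alpha_p$ be a root of its Hecke polynomial $X^2-a_pX+p^{k-1}$ at $p$, and let $s_p=v_p(\alpha_p)$. Let $\lambda_0=\frac{k-4}{2}(2\alpha+3\beta)$. Then \[s_p(2\alpha+3\beta)+\beta-\lambda_0+w_\beta*\lambda_0=s_p(2\alpha+3\beta),\] which is a nonnegative rational combination of positive roots. Furthermore, if $k>4s_p+4$, then for every $w\in W$ with $w\neq1,w_\beta$, the weight $s_p(2\alpha+3\beta)+\beta-\lambda_0+w*\lambda_0$ is not a nonnegative rational combination of positive roots.
   Context: The root system of $G_2$ has simple roots $\alpha$ (long) and $\beta$ (short), positive roots $\alpha,\beta,\alpha+\beta,\alpha+2\beta,\alpha+3\beta,2\alpha+3\beta$, and $\rho=3\alpha+5\beta$. $W$ is the Weyl group (dihedral of order 12), $w_\gamma$ is the reflection in the line orthogonal to the root $\gamma$, and $w*\lambda=w(\lambda+\rho)-\rho$. $v_p$ is the $p$-adic valuation on $\overline{\mathbb{Q}}_p$ with $v_p(p)=1$. -}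

module Defs where

open import Data.Nat as ℕ using (ℕ)
open import Data.Integer using (+_)
open import Data.Rational using (ℚ; _+_; _*_; -_; _-_; _/_; 0ℚ; 1ℚ; _≤_)
open import Data.Product using (_×_; _,_; Σ)
open import Data.Fin using (Fin; zero; suc)
open import Data.List using (List; []; _∷_)
open import Relation.Binary.PropositionalEquality using (_≡_)

ℚ[_] : ℕ → ℚ
ℚ[ n ] = + n / 1

-- A weight of G₂, written in the basis of simple roots:
-- (a , b) stands for a·α + b·β  (α long, β short).
Weight : Set
Weight = ℚ × ℚ

infixl 6 _⊕_ _⊖_
infixr 7 _•_

_⊕_ : Weight → Weight → Weight
(a , b) ⊕ (c , d) = (a + c , b + d)

_⊖_ : Weight → Weight → Weight
(a , b) ⊖ (c , d) = (a - c , b - d)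

_•_ : ℚ → Weight → Weight
q • (a , b) = (q * a , q * b)

α β : Weight
α = (1ℚ , 0ℚ)
β = (0ℚ , 1ℚ)

posRoot : Fin 6 → Weight
posRoot zero = α
posRoot (suc zero) = β
posRoot (suc (suc zero)) = α ⊕ β
posRoot (suc (suc (suc zero))) = α ⊕ ℚ[ 2 ] • β
posRoot (suc (suc (suc (suc zero)))) = α ⊕ ℚ[ 3 ] • β
posRoot (suc (suc (suc (suc (suc zero))))) = ℚ[ 2 ] • α ⊕ ℚ[ 3 ] • β

θ : Weight
θ = ℚ[ 2 ] • α ⊕ ℚ[ 3 ] • β

-- ρ = half the sum of positive roots = 3α + 5β
ρ : Weight
ρ = ℚ[ 3 ] • α ⊕ ℚ[ 5 ] • β

sumW : ∀ {n} → (Fin n → Weight) → Weight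
sumW {ℕ.zero} f = (0ℚ , 0ℚ)
sumW {ℕ.suc n} f = f zero ⊕ sumW (λ i → f (suc i))

NonnegComb : Weight → Set
NonnegComb μ = Σ (Fin 6 → ℚ) λ c → ((i : Fin 6) → 0ℚ ≤ c i) × (μ ≡ sumW (λ i → c i • posRoot i))

-- Simple reflections, acting linearly on weights written in the (α, β) basis.
-- With (α,α)=3, (β,β)=1, (α,β)=-3/2 one has
--   w_α(α) = -α, w_α(β) = α + β,   w_β(α) = α + 3β, w_β(β) = -β.
data Gen : Set where
  sα sβ : Gen

reflect : Gen → Weight → Weight
reflect sα (a , b) = (b - a , b)
reflect sβ (a , b) = (a , ℚ[ 3 ] * a - b)

-- An element of the Weyl group W is presented by a word in the simple
-- reflections; the word s₁ ∷ s₂ ∷ … ∷ sₙ denotes the product s₁ s₂ ⋯ sₙ.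
WeylWord : Set
WeylWord = List Gen

act : WeylWord → Weight → Weight
act [] x = x
act (s ∷ w) x = reflect s (act w x)

-- Equality of Weyl group elements = equality of the linear maps,
-- i.e. agreement on the basis α, β.
_≈W_ : WeylWord → WeylWord → Set
w ≈W w' = (act w α ≡ act w' α) × (act w β ≡ act w' β)

one wβ : WeylWord
one = []
wβ = sβ ∷ []

dot : WeylWord → Weight → Weight
dot w l = act w (l ⊕ ρ) ⊖ ρ

λ₀ : ℕ → Weight
λ₀ k = (+ (k ℕ.∸ 4) / 2) • θ

μ : ℚ → ℕ → WeylWord → Weight
μ s k w = s • θ ⊕ β ⊖ λ₀ k ⊕ dot w (λ₀ k)

-- Only the α-coefficient of μ matters: every positive root has a nonnegative
-- α-coefficient.  Write λ₀ = c θ with c = (k − 4)/2 and let a(ν) be the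
-- α-coefficient of ν.  Then a(μ_w) = 2s − 2c + c·a(wθ) + a(wρ) − 3.  The
-- stabiliser of θ is {1, w_β}; for any other w, wθ is a root different from θ,
-- so a(wθ) ≤ 1, and ρ − wρ is a sum of positive roots not all equal to β, so
-- a(wρ) ≤ 2.  Hence a(μ_w) ≤ 2s − c − 1 < 0 once k > 4s + 4.  Both bounds are
-- checked on the twelve elements of W.  For w = w_β itself, w_β fixes θ and
-- w_β ρ = ρ − β, which gives μ = sθ.
{-# OPTIONS --safe #-}
module Submission where

open import Defs
open import Data.Nat using (ℕ; _≤_)
open import Data.Rational using (ℚ; 0ℚ; _*_; _+_)
open import Data.Product using (_×_)
open import Relation.Binary.PropositionalEquality using (_≡_)
open import Relation.Nullary using (¬_)
import Data.Rational as Q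

open import Data.Nat as ℕ using (s≤s; z≤n)
open import Data.Integer as ℤ using (+_)
import Data.Integer.Properties as ℤ
open import Data.Integer.Tactic.RingSolver using (solve-∀)
open import Data.Rational using (1ℚ; -_; _-_; _/_; _≟_; _≤?_; toℚᵘ; nonNegative)
open import Data.Rational.Properties
  using ( ≤-refl; <-irrefl; +-inverseʳ; +-mono-≤; +-monoˡ-≤; +-monoˡ-<; +-mono-≤-<
        ; nonNegative⁻¹; nonNeg*nonNeg⇒nonNeg; normalize-nonNeg
        ; toℚᵘ-injective; toℚᵘ-fromℚᵘ; toℚᵘ-homo-+; toℚᵘ-homo-* )
import Data.Rational.Unnormalised as ℚᵘ
import Data.Rational.Unnormalised.Properties as ℚᵘ
open import Data.Rational.Solver using (module +-*-Solver)
open import Data.Product using (_,_; proj₁)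
open import Data.Product.Properties using (≡-dec)
open import Data.Fin using (Fin; zero; suc)
open import Data.Fin.Properties using () renaming (all? to allFin?)
open import Data.List using (List; []; _∷_)
open import Data.List.Relation.Unary.All using (All; all?; lookupWith)
open import Data.List.Relation.Unary.Any as Any using (Any; here; there; any?)
open import Data.Empty using (⊥-elim)
open import Relation.Binary.Definitions using (DecidableEquality; Decidable)
open import Relation.Binary.PropositionalEquality
  using (_≢_; refl; sym; trans; cong; cong₂; subst; module ≡-Reasoning)
open import Relation.Nullary.Decidable using (_×-dec_; from-yes)

open +-*-Solver

nonneg*nonneg : ∀ {p q} → 0ℚ Q.≤ p → 0ℚ Q.≤ q → 0ℚ Q.≤ p * q
nonneg*nonneg {p} {q} 0≤p 0≤q =
  nonNegative⁻¹ (p * q) {{nonNeg*nonNeg⇒nonNeg p {{nonNegative 0≤p}} q {{nonNegative 0≤q}}}}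

p≤q⇒0≤q-p : ∀ {p q} → p Q.≤ q → 0ℚ Q.≤ q - p
p≤q⇒0≤q-p {p} {q} p≤q = subst (Q._≤ q - p) (+-inverseʳ p) (+-monoˡ-≤ (- p) p≤q)

p<q⇒0<q-p : ∀ {p q} → p Q.< q → 0ℚ Q.< q - p
p<q⇒0<q-p {p} {q} p<q = subst (Q._< q - p) (+-inverseʳ p) (+-monoˡ-< (- p) p<q)

nonneg+pos≢0 : ∀ {p q} → 0ℚ Q.≤ p → 0ℚ Q.< q → p + q ≢ 0ℚ
nonneg+pos≢0 0≤p 0<q p+q≡0 = <-irrefl (sym p+q≡0) (+-mono-≤-< 0≤p 0<q)

0≤2 : 0ℚ Q.≤ ℚ[ 2 ]
0≤2 = nonNegative⁻¹ ℚ[ 2 ]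

ℚ[4+m]≡4+2*m/2 : ∀ m → ℚ[ 4 ℕ.+ m ] ≡ ℚ[ 4 ] + ℚ[ 2 ] * (+ m / 2)
ℚ[4+m]≡4+2*m/2 m = toℚᵘ-injective (begin-equality
  toℚᵘ ℚ[ 4 ℕ.+ m ]
    ≃⟨ toℚᵘ-fromℚᵘ (ℚᵘ.mkℚᵘ (+ (4 ℕ.+ m)) 0) ⟩
  ℚᵘ.mkℚᵘ (+ (4 ℕ.+ m)) 0
    ≃⟨ ℚᵘ.*≡* (trans (cong (ℤ._* + 2) (ℤ.pos-+ 4 m)) (cross-multiplied (+ m))) ⟩
  toℚᵘ ℚ[ 4 ] ℚᵘ.+ toℚᵘ ℚ[ 2 ] ℚᵘ.* ℚᵘ.mkℚᵘ (+ m) 1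
    ≃⟨ ℚᵘ.+-congʳ (toℚᵘ ℚ[ 4 ]) (ℚᵘ.*-congˡ {toℚᵘ ℚ[ 2 ]} (toℚᵘ-fromℚᵘ (ℚᵘ.mkℚᵘ (+ m) 1))) ⟨
  toℚᵘ ℚ[ 4 ] ℚᵘ.+ toℚᵘ ℚ[ 2 ] ℚᵘ.* toℚᵘ (+ m / 2)
    ≃⟨ ℚᵘ.+-congʳ (toℚᵘ ℚ[ 4 ]) (toℚᵘ-homo-* ℚ[ 2 ] (+ m / 2)) ⟨
  toℚᵘ ℚ[ 4 ] ℚᵘ.+ toℚᵘ (ℚ[ 2 ] * (+ m / 2))
    ≃⟨ toℚᵘ-homo-+ ℚ[ 4 ] (ℚ[ 2 ] * (+ m / 2)) ⟨
  toℚᵘ (ℚ[ 4 ] + ℚ[ 2 ] * (+ m / 2))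
    ∎)
  where
  open ℚᵘ.≤-Reasoning
  cross-multiplied : ∀ x → (+ 4 ℤ.+ x) ℤ.* + 2 ≡ (+ 4 ℤ.* + 2 ℤ.+ (+ 2 ℤ.* x) ℤ.* + 1) ℤ.* + 1
  cross-multiplied = solve-∀

αcoeff : Weight → ℚ
αcoeff = proj₁

reflect-linear : ∀ g a b x y → reflect g (a • x ⊕ b • y) ≡ a • reflect g x ⊕ b • reflect g y
reflect-linear sα a b (x₁ , x₂) (y₁ , y₂) = cong (_, _)
  (solve 6 (λ a b x₁ x₂ y₁ y₂ →
     (a :* x₂ :+ b :* y₂) :- (a :* x₁ :+ b :* y₁) := a :* (x₂ :- x₁) :+ b :* (y₂ :- y₁))
   refl a b x₁ x₂ y₁ y₂)
reflect-linear sβ a b (x₁ , x₂) (y₁ , y₂) = cong (_ ,_)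
  (solve 6 (λ a b x₁ x₂ y₁ y₂ →
     con ℚ[ 3 ] :* (a :* x₁ :+ b :* y₁) :- (a :* x₂ :+ b :* y₂)
       := a :* (con ℚ[ 3 ] :* x₁ :- x₂) :+ b :* (con ℚ[ 3 ] :* y₁ :- y₂))
   refl a b x₁ x₂ y₁ y₂)

act-linear : ∀ w a b x y → act w (a • x ⊕ b • y) ≡ a • act w x ⊕ b • act w y
act-linear []      a b x y = refl
act-linear (g ∷ w) a b x y =
  trans (cong (reflect g) (act-linear w a b x y)) (reflect-linear g a b (act w x) (act w y))

weight-basis : ∀ a b → (a , b) ≡ a • α ⊕ b • β
weight-basis a b = cong₂ _,_
  (solve 2 (λ a b → a := a :* con 1ℚ :+ b :* con 0ℚ) refl a b)
  (solve 2 (λ a b → b := a :* con 0ℚ :+ b :* con 1ℚ) refl a b)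

≈W⇒act≡ : ∀ {w v} → w ≈W v → ∀ x → act w x ≡ act v x
≈W⇒act≡ {w} {v} (wα≡vα , wβ≡vβ) (a , b) = begin
  act w (a , b)               ≡⟨ cong (act w) (weight-basis a b) ⟩
  act w (a • α ⊕ b • β)       ≡⟨ act-linear w a b α β ⟩
  a • act w α ⊕ b • act w β   ≡⟨ cong₂ (λ x y → a • x ⊕ b • y) wα≡vα wβ≡vβ ⟩
  a • act v α ⊕ b • act v β   ≡⟨ act-linear v a b α β ⟨
  act v (a • α ⊕ b • β)       ≡⟨ cong (act v) (weight-basis a b) ⟨
  act v (a , b)               ∎
  where open ≡-Reasoning

≈W-trans : ∀ {u v w} → u ≈W v → v ≈W w → u ≈W w
≈W-trans (p , q) (p′ , q′) = trans p p′ , trans q q′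

≈W-∷ : ∀ g {w v} → w ≈W v → (g ∷ w) ≈W (g ∷ v)
≈W-∷ g (p , q) = cong (reflect g) p , cong (reflect g) q

_≟ᵂ_ : DecidableEquality Weight
_≟ᵂ_ = ≡-dec _≟_ _≟_

_≈W?_ : Decidable _≈W_
w ≈W? v = (act w α ≟ᵂ act v α) ×-dec (act w β ≟ᵂ act v β)

otherElements : List WeylWord
otherElements =
  (sα ∷ []) ∷
  (sα ∷ sβ ∷ []) ∷ (sβ ∷ sα ∷ []) ∷
  (sα ∷ sβ ∷ sα ∷ []) ∷ (sβ ∷ sα ∷ sβ ∷ []) ∷
  (sα ∷ sβ ∷ sα ∷ sβ ∷ []) ∷ (sβ ∷ sα ∷ sβ ∷ sα ∷ []) ∷
  (sα ∷ sβ ∷ sα ∷ sβ ∷ sα ∷ []) ∷ (sβ ∷ sα ∷ sβ ∷ sα ∷ sβ ∷ []) ∷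
  (sα ∷ sβ ∷ sα ∷ sβ ∷ sα ∷ sβ ∷ []) ∷ []

weylElements : List WeylWord
weylElements = one ∷ wβ ∷ otherElements

weylElements-closed : ∀ g → All (λ v → Any ((g ∷ v) ≈W_) weylElements) weylElements
weylElements-closed sα = from-yes (all? (λ v → any? ((sα ∷ v) ≈W?_) weylElements) weylElements)
weylElements-closed sβ = from-yes (all? (λ v → any? ((sβ ∷ v) ≈W?_) weylElements) weylElements)

weylElements-complete : ∀ w → Any (w ≈W_) weylElements
weylElements-complete []      = here (refl , refl)
weylElements-complete (g ∷ w) =
  lookupWith {R = λ _ → Any ((g ∷ w) ≈W_) weylElements} (λ {v} → step {v})
    (weylElements-closed g) (weylElements-complete w)
  where
  step : ∀ {v} → Any ((g ∷ v) ≈W_) weylElements → w ≈W v → Any ((g ∷ w) ≈W_) weylElements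
  step {v} gv≈ w≈v = Any.map (λ {u} → ≈W-trans {g ∷ w} {g ∷ v} {u} (≈W-∷ g {w} {v} w≈v)) gv≈

-- θ and ρ have α-coefficients 2 and 3.
LowersαCoefficients : WeylWord → Set
LowersαCoefficients w = αcoeff (act w θ) Q.≤ 1ℚ × αcoeff (act w ρ) Q.≤ ℚ[ 2 ]

otherElements-lower : All LowersαCoefficients otherElements
otherElements-lower = from-yes
  (all? (λ w → (αcoeff (act w θ) ≤? 1ℚ) ×-dec (αcoeff (act w ρ) ≤? ℚ[ 2 ])) otherElements)

≈W-lowersαCoefficients : ∀ {w v} → w ≈W v → LowersαCoefficients v → LowersαCoefficients w
≈W-lowersαCoefficients {w} {v} w≈v (vθ≤1 , vρ≤2) =
  subst (λ x → αcoeff x Q.≤ 1ℚ) (sym (≈W⇒act≡ {w} {v} w≈v θ)) vθ≤1 ,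
  subst (λ x → αcoeff x Q.≤ ℚ[ 2 ]) (sym (≈W⇒act≡ {w} {v} w≈v ρ)) vρ≤2

lowersαCoefficients : ∀ w → ¬ (w ≈W one) → ¬ (w ≈W wβ) → LowersαCoefficients w
lowersαCoefficients w w≉1 w≉wβ with weylElements-complete w
... | here w≈1              = ⊥-elim (w≉1 w≈1)
... | there (here w≈wβ)     = ⊥-elim (w≉wβ w≈wβ)
... | there (there w≈other) = lookupWith {R = λ _ → LowersαCoefficients w}
  (λ {v} lowers w≈v → ≈W-lowersαCoefficients {w} {v} w≈v lowers) otherElements-lower w≈other

sumW-αcoeff-nonneg : ∀ {n} (f : Fin n → Weight) →
  (∀ i → 0ℚ Q.≤ αcoeff (f i)) → 0ℚ Q.≤ αcoeff (sumW f)
sumW-αcoeff-nonneg {ℕ.zero}  f f≥0 = ≤-refl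
sumW-αcoeff-nonneg {ℕ.suc n} f f≥0 =
  +-mono-≤ (f≥0 zero) (sumW-αcoeff-nonneg (λ i → f (suc i)) (λ i → f≥0 (suc i)))

posRoot-αcoeff-nonneg : ∀ i → 0ℚ Q.≤ αcoeff (posRoot i)
posRoot-αcoeff-nonneg = from-yes (allFin? (λ i → 0ℚ ≤? αcoeff (posRoot i)))

nonnegComb⇒αcoeff-nonneg : ∀ {ν} → NonnegComb ν → 0ℚ Q.≤ αcoeff ν
nonnegComb⇒αcoeff-nonneg (c , c≥0 , refl) =
  sumW-αcoeff-nonneg (λ i → c i • posRoot i) (λ i → nonneg*nonneg (c≥0 i) (posRoot-αcoeff-nonneg i))

nonnegComb-θ : ∀ {s} → 0ℚ Q.≤ s → NonnegComb (s • θ)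
nonnegComb-θ {s} 0≤s = coeff , coeff≥0 , cong₂ _,_
  (solve 1 (λ s → s :* con ℚ[ 2 ]
     := con 0ℚ :+ (con 0ℚ :+ (con 0ℚ :+ (con 0ℚ :+ (con 0ℚ :+ (s :* con ℚ[ 2 ] :+ con 0ℚ)))))) refl s)
  (solve 1 (λ s → s :* con ℚ[ 3 ]
     := con 0ℚ :+ (con 0ℚ :+ (con 0ℚ :+ (con 0ℚ :+ (con 0ℚ :+ (s :* con ℚ[ 3 ] :+ con 0ℚ)))))) refl s)
  where
  coeff : Fin 6 → ℚ
  coeff (suc (suc (suc (suc (suc zero))))) = s
  coeff _                                  = 0ℚ
  coeff≥0 : ∀ i → 0ℚ Q.≤ coeff i
  coeff≥0 zero                                   = ≤-refl
  coeff≥0 (suc zero)                             = ≤-refl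
  coeff≥0 (suc (suc zero))                       = ≤-refl
  coeff≥0 (suc (suc (suc zero)))                 = ≤-refl
  coeff≥0 (suc (suc (suc (suc zero))))           = ≤-refl
  coeff≥0 (suc (suc (suc (suc (suc zero)))))     = 0≤s

-- μ s k w is definitionally μ′ s c w with c = (k ∸ 4)/2, i.e. λ₀ = c θ.
μ′ : ℚ → ℚ → WeylWord → Weight
μ′ s c w = s • θ ⊕ β ⊖ c • θ ⊕ dot w (c • θ)

μ′-wβ : ∀ s c → μ′ s c wβ ≡ s • θ
μ′-wβ s c = cong₂ _,_
  (solve 2 (λ s c →
     ((s :* con ℚ[ 2 ] :+ con 0ℚ) :- c :* con ℚ[ 2 ]) :+ ((c :* con ℚ[ 2 ] :+ con ℚ[ 3 ]) :- con ℚ[ 3 ])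
       := s :* con ℚ[ 2 ]) refl s c)
  (solve 2 (λ s c →
     ((s :* con ℚ[ 3 ] :+ con 1ℚ) :- c :* con ℚ[ 3 ])
       :+ ((con ℚ[ 3 ] :* (c :* con ℚ[ 2 ] :+ con ℚ[ 3 ]) :- (c :* con ℚ[ 3 ] :+ con ℚ[ 5 ])) :- con ℚ[ 5 ])
       := s :* con ℚ[ 3 ]) refl s c)

-- With m = a(μ′), u = a(wθ), v = a(wρ) and k = 4 + 2c, this reads
-- 2m + 2c(1 − u) + 2(2 − v) + 2 + (k − (4s + 4)) = 0.
μ′-αcoeff-identity : ∀ s c u v →
  let m = ((s * ℚ[ 2 ] + 0ℚ) - c * ℚ[ 2 ]) + ((c * u + 1ℚ * v) - ℚ[ 3 ]) in
  (m + m + ℚ[ 2 ] * c * (1ℚ - u) + ℚ[ 2 ] * (ℚ[ 2 ] - v) + ℚ[ 2 ])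
    + ((ℚ[ 4 ] + ℚ[ 2 ] * c) - (ℚ[ 4 ] * s + ℚ[ 4 ])) ≡ 0ℚ
μ′-αcoeff-identity = solve 4 (λ s c u v →
  let m = ((s :* con ℚ[ 2 ] :+ con 0ℚ) :- c :* con ℚ[ 2 ]) :+ ((c :* u :+ con 1ℚ :* v) :- con ℚ[ 3 ]) in
  (m :+ m :+ con ℚ[ 2 ] :* c :* (con 1ℚ :- u) :+ con ℚ[ 2 ] :* (con ℚ[ 2 ] :- v) :+ con ℚ[ 2 ])
    :+ ((con ℚ[ 4 ] :+ con ℚ[ 2 ] :* c) :- (con ℚ[ 4 ] :* s :+ con ℚ[ 4 ])) := con 0ℚ) refl

μ′-αcoeff-negative : ∀ s c w → 0ℚ Q.≤ c → ℚ[ 4 ] * s + ℚ[ 4 ] Q.< ℚ[ 4 ] + ℚ[ 2 ] * c →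
  LowersαCoefficients w → ¬ (0ℚ Q.≤ αcoeff (μ′ s c w))
μ′-αcoeff-negative s c w 0≤c 4s+4<k (u≤1 , v≤2) 0≤m =
  nonneg+pos≢0 rest-nonneg (p<q⇒0<q-p 4s+4<k)
    (trans (cong (λ m → (m + m + ℚ[ 2 ] * c * (1ℚ - u) + ℚ[ 2 ] * (ℚ[ 2 ] - v) + ℚ[ 2 ]) + _) m≡)
           (μ′-αcoeff-identity s c u v))
  where
  u v m : ℚ
  u = αcoeff (act w θ)
  v = αcoeff (act w ρ)
  m = αcoeff (μ′ s c w)
  m≡ : m ≡ ((s * ℚ[ 2 ] + 0ℚ) - c * ℚ[ 2 ]) + ((c * u + 1ℚ * v) - ℚ[ 3 ])
  m≡ = cong (λ x → ((s * ℚ[ 2 ] + 0ℚ) - c * ℚ[ 2 ]) + (αcoeff x - ℚ[ 3 ])) (act-linear w c 1ℚ θ ρ)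
  rest-nonneg : 0ℚ Q.≤ m + m + ℚ[ 2 ] * c * (1ℚ - u) + ℚ[ 2 ] * (ℚ[ 2 ] - v) + ℚ[ 2 ]
  rest-nonneg = +-mono-≤ (+-mono-≤ (+-mono-≤ (+-mono-≤ 0≤m 0≤m)
    (nonneg*nonneg (nonneg*nonneg 0≤2 0≤c) (p≤q⇒0≤q-p u≤1)))
    (nonneg*nonneg 0≤2 (p≤q⇒0≤q-p v≤2))) 0≤2

proposition3p6 : (k : ℕ) → 4 ≤ k → (s : ℚ) → 0ℚ Q.≤ s → s Q.≤ ℚ[ k ] Q.- ℚ[ 1 ] →
    (μ s k wβ ≡ s • θ × NonnegComb (s • θ))
    × (ℚ[ k ] Q.> ℚ[ 4 ] * s + ℚ[ 4 ] →
       (w : WeylWord) → ¬ (w ≈W one) → ¬ (w ≈W wβ) → ¬ NonnegComb (μ s k w))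
proposition3p6 k (s≤s (s≤s (s≤s (s≤s (z≤n {m}))))) s 0≤s _ =
  (μ′-wβ s c , nonnegComb-θ 0≤s) ,
  λ k>4s+4 w w≉1 w≉wβ nonneg →
    μ′-αcoeff-negative s c w 0≤c (subst (ℚ[ 4 ] * s + ℚ[ 4 ] Q.<_) (ℚ[4+m]≡4+2*m/2 m) k>4s+4)
      (lowersαCoefficients w w≉1 w≉wβ) (nonnegComb⇒αcoeff-nonneg nonneg)
  where
  c : ℚ
  c = + m / 2
  0≤c : 0ℚ Q.≤ c
  0≤c = nonNegative⁻¹ c {{normalize-nonNeg m 2}}
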